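{- Let $n\ge5$ be an odd integer and let $\Omega=\{T\in\mathcal B(C_n): |T|=n\}$. Then $\Omega$ is not minimal with respect to $d_{\Omega}(C_n)=2n-1$; that is, there is a proper subset $\Omega_1\subsetneq\Omega$ with $d_{\Omega_1}(C_n)=2n-1$.
   Context: $C_n$ is the cyclic group of order $n$, written additively. A sequence over $C_n$ is a finite unordered list of elements with repetition allowed; $|T|$ is its length; a subsequence uses each element at most as often as the sequence does. $\mathcal B(C_n)$ is the set of all nonempty sequences over $C_n$ whose terms sum to $0$. For $\Omega\subset\mathcal B(C_n)$, $d_{\Omega}(C_n)$ is the smallest integer $t$ such that every sequence over $C_n$ of length at least $t$ has a subsequence belonging to $\Omega$. (For the given $\Omega$, $d_\Omega(C_n)=2n-1$ by the Erdős–Ginzburg–Ziv theorem.) $\Omega$ is minimal with respect to $d_{\Omega}=t$ if $d_\Omega=t$ and $d_{\Omega'}>t$ for every proper subset $\Omega'\subsetneq\Omega$. -}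

module Defs where

open import Level using (0ℓ)
open import Data.Nat using (ℕ; _*_; _≤_; _<_)
open import Data.Nat.Divisibility using (_∣_)
open import Data.Fin using (Fin; toℕ)
open import Data.Vec using (Vec; sum; zipWith; allFin)
open import Data.Vec.Relation.Binary.Pointwise.Inductive using (Pointwise)
open import Data.Product using (Σ; _×_)
open import Relation.Nullary using (¬_)
open import Relation.Binary.PropositionalEquality using (_≡_)
open import Relation.Unary using (Pred)

-- A sequence over C_n (C_n ≅ Fin n, written additively, addition mod n),
-- unordered with repetition: represented by its multiplicity vector,
-- entry g = number of occurrences of the element g ∈ Fin n.
Seq : ℕ → Set
Seq n = Vec ℕ n

len : ∀ {n} → Seq n → ℕ
len s = sum s

-- the sum of the terms, as a natural number representative (reduce mod n)
σ : ∀ {n} → Seq n → ℕ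
σ {n} s = sum (zipWith (λ g c → toℕ g * c) (allFin n) s)

_⊑_ : ∀ {n} → Seq n → Seq n → Set
T ⊑ S = Pointwise _≤_ T S

InB : (n : ℕ) → Seq n → Set
InB n T = (0 < len T) × (n ∣ σ T)

Omega : (n : ℕ) → Pred (Seq n) 0ℓ
Omega n T = InB n T × (len T ≡ n)

HasSubIn : ∀ {n} → Pred (Seq n) 0ℓ → Seq n → Set
HasSubIn {n} Ω S = Σ (Seq n) (λ T → (T ⊑ S) × Ω T)

Forces : ∀ {n} → Pred (Seq n) 0ℓ → ℕ → Set
Forces {n} Ω t = (S : Seq n) → t ≤ len S → HasSubIn Ω S

DEq : ∀ {n} → Pred (Seq n) 0ℓ → ℕ → Set
DEq Ω t = Forces Ω t × ((t' : ℕ) → t' < t → ¬ Forces Ω t')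

module Submission where

open import Defs
open import Level using (0ℓ)
open import Data.Nat using (ℕ; _*_; _∸_; _≤_)
open import Data.Nat.Divisibility using (_∣_)
open import Data.Product using (Σ; _×_)
open import Relation.Nullary using (¬_)
open import Relation.Unary using (Pred; _⊆_)
open import Data.Nat using (suc; s≤s; z<s)
open import Data.Product using (_,_; proj₁)
open import Relation.Binary.PropositionalEquality using (refl)

-- For odd n ≥ 5 the family Ω = { T ∈ 𝓑(C_n) : |T| = n } is not minimal for
-- d_Ω(C_n) = 2n - 1: removing the single sequence U = 0 · 1 · … · (n-1), which
-- lies in Ω because n ∣ n(n-1)/2 for odd n, leaves a family Ω₁ with d = 2n - 1.
--
-- Lower bound: 0^{n-1} 1^{n-1} has length 2n - 2 and no n-term zero-sum subsequence.
-- Upper bound: by the Erdős–Ginzburg–Ziv (EGZ) theorem every S with |S| ≥ 2n - 1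
-- has an n-term zero-sum subsequence T.  If T = U, then S has n - 1 ≥ 2 further
-- terms x, y; as n ≥ 5 there are a ≠ b with a ∉ {x, y} and a + b = x + y, and
-- exchanging a, b for x, y gives a zero-sum subsequence different from U.

module ModularArithmetic where

  open import Data.Nat
  open import Data.Nat.Properties
  open import Data.Nat.DivMod
  open import Data.Nat.Divisibility using (_∣_; m%n≡0⇒n∣m; n∣m⇒m%n≡0)
  open import Relation.Binary.Bundles using (Setoid)
  open import Relation.Binary.PropositionalEquality
  import Relation.Binary.Reasoning.Setoid
  open import Relation.Nullary using (Dec)
  open import Relation.Nullary.Decidable using (map′)

  -- Congruence modulo a nonzero modulus p: the additive group C_p is
  -- handled through natural-number representatives compared by residue.
  module Congruence (p : ℕ) .{{_ : NonZero p}} where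

    infix 4 _≈_
    record _≈_ (x y : ℕ) : Set where
      constructor mk
      field ≈eq : x % p ≡ y % p
    open _≈_ public

    ≈-refl : ∀ {x} → x ≈ x
    ≈-refl = mk refl

    ≈-sym : ∀ {x y} → x ≈ y → y ≈ x
    ≈-sym (mk e) = mk (sym e)

    ≈-trans : ∀ {x y z} → x ≈ y → y ≈ z → x ≈ z
    ≈-trans (mk e) (mk e′) = mk (trans e e′)

    ≈-setoid : Setoid 0ℓ 0ℓ
    ≈-setoid = record
      { Carrier = ℕ ; _≈_ = _≈_
      ; isEquivalence = record { refl = ≈-refl ; sym = ≈-sym ; trans = ≈-trans } }

    module ≈-Reasoning = Relation.Binary.Reasoning.Setoid ≈-setoid

    _≈?_ : ∀ x y → Dec (x ≈ y)
    x ≈? y = map′ mk ≈eq (x % p ≟ y % p)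

    ≡⇒≈ : ∀ {x y} → x ≡ y → x ≈ y
    ≡⇒≈ refl = ≈-refl

    %≈ : ∀ x → x % p ≈ x
    %≈ x = mk (m%n%n≡m%n x p)

    +-cong : ∀ {a b c d} → a ≈ b → c ≈ d → a + c ≈ b + d
    +-cong {a} {b} {c} {d} (mk e₁) (mk e₂) = mk (begin
      (a + c) % p         ≡⟨ %-distribˡ-+ a c p ⟩
      (a % p + c % p) % p ≡⟨ cong₂ (λ u v → (u + v) % p) e₁ e₂ ⟩
      (b % p + d % p) % p ≡⟨ %-distribˡ-+ b d p ⟨
      (b + d) % p         ∎)
      where open ≡-Reasoning

    *-cong : ∀ {a b c d} → a ≈ b → c ≈ d → a * c ≈ b * d
    *-cong {a} {b} {c} {d} (mk e₁) (mk e₂) = mk (begin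
      (a * c) % p             ≡⟨ %-distribˡ-* a c p ⟩
      (a % p * (c % p)) % p   ≡⟨ cong₂ (λ u v → (u * v) % p) e₁ e₂ ⟩
      (b % p * (d % p)) % p   ≡⟨ %-distribˡ-* b d p ⟨
      (b * d) % p             ∎)
      where open ≡-Reasoning

    +-multiple : ∀ x k → x + k * p ≈ x
    +-multiple x k = mk ([m+kn]%n≡m%n x k p)

    multiple≈0 : ∀ k → k * p ≈ 0
    multiple≈0 k = +-multiple 0 k

    p≈0 : p ≈ 0
    p≈0 = ≈-trans (≡⇒≈ (sym (*-identityˡ p))) (multiple≈0 1)

    0%p≡0 : 0 % p ≡ 0
    0%p≡0 = m*n%n≡0 0 p

    ≈0⇒∣ : ∀ {x} → x ≈ 0 → p ∣ x
    ≈0⇒∣ {x} (mk e) = m%n≡0⇒n∣m x p (trans e 0%p≡0)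

    ∣⇒≈0 : ∀ {x} → p ∣ x → x ≈ 0
    ∣⇒≈0 {x} d = mk (trans (n∣m⇒m%n≡0 x p d) (sym 0%p≡0))

    neg : ℕ → ℕ
    neg x = p ∸ x % p

    +-neg : ∀ x → x + neg x ≈ 0
    +-neg x = begin
      x + neg x                    ≈⟨ +-cong (≈-sym (%≈ x)) ≈-refl ⟩
      x % p + (p ∸ x % p)          ≡⟨ m+[n∸m]≡n (<⇒≤ (m%n<n x p)) ⟩
      p                            ≈⟨ p≈0 ⟩
      0                            ∎
      where open ≈-Reasoning

    +-cancelʳ : ∀ {a b} c → a + c ≈ b + c → a ≈ b
    +-cancelʳ {a} {b} c e = begin
      a                  ≡⟨ +-identityʳ a ⟨
      a + 0              ≈⟨ +-cong ≈-refl (≈-sym (+-neg c)) ⟩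
      a + (c + neg c)    ≡⟨ +-assoc a c _ ⟨
      a + c + neg c      ≈⟨ +-cong e ≈-refl ⟩
      b + c + neg c      ≡⟨ +-assoc b c _ ⟩
      b + (c + neg c)    ≈⟨ +-cong ≈-refl (+-neg c) ⟩
      b + 0              ≡⟨ +-identityʳ b ⟩
      b                  ∎
      where open ≈-Reasoning

    residue-≡ : ∀ {x y} → x < p → y < p → x ≈ y → x ≡ y
    residue-≡ x<p y<p (mk e) = trans (sym (m<n⇒m%n≡m x<p)) (trans e (m<n⇒m%n≡m y<p))

module Covering where

  open import Data.Nat
  open import Data.Nat.Properties
  open import Data.Nat.DivMod
  open import Data.Nat.Coprimality using (coprime-Bézout; prime⇒coprime)
  import Data.Nat.Coprimality as Coprimality
  open import Data.Nat.GCD using (module Bézout)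
  open import Data.Nat.Primality using (Prime)
  open import Data.Nat.ListAction using (sum)
  open import Data.List using (List; []; _∷_; _++_; length; map; upTo)
  open import Data.List.Properties using (length-++; length-upTo)
  open import Data.List.Relation.Unary.All as All using (All; []; _∷_)
  open import Data.List.Relation.Unary.All.Properties using (¬Any⇒All¬)
  open import Data.List.Relation.Unary.Any using (here; there; any?)
  open import Data.List.Relation.Unary.Unique.Propositional using (Unique)
  open import Data.List.Relation.Unary.AllPairs using ([]; _∷_)
  open import Data.List.Relation.Unary.Unique.Propositional.Properties using (Unique[x∷xs]⇒x∉xs)
  open import Data.List.Membership.Propositional using (_∈_; find; lose)
  open import Data.List.Membership.Propositional.Properties using (∈-∃++; ∈-++⁻; ∈-++⁺ˡ; ∈-++⁺ʳ; ∈-upTo⁺)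
  open import Data.List.Membership.DecPropositional _≟_ using (_∈?_)
  open import Data.List.Relation.Binary.Pointwise using (Pointwise; []; _∷_)
  open import Data.List.Relation.Binary.Permutation.Propositional using (_↭_; prep; swap; ↭-trans; ↭-sym; ↭-refl)
  open import Data.List.Relation.Binary.Permutation.Propositional.Properties using (shift)
  open import Data.Product using (Σ; _×_; _,_; proj₁; proj₂; ∃)
  open import Data.Sum using (_⊎_; inj₁; inj₂)
  open import Relation.Nullary using (¬_; yes; no; contradiction)
  open import Relation.Nullary.Decidable using (¬?; decidable-stable)
  open import Relation.Binary.PropositionalEquality
  open import Data.Nat.Solver using (module +-*-Solver)
  open +-*-Solver
  open ModularArithmetic

  module Pigeonhole where

    unique-length-≤ : ∀ {X : Set} (V M : List X) → Unique V → All (_∈ M) V → length V ≤ length M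
    unique-length-≤ [] M _ _ = z≤n
    unique-length-≤ (v ∷ V) M (v∉V ∷ uV) (v∈M ∷ V⊆M) with ∈-∃++ v∈M
    ... | M₁ , M₂ , refl = begin
        suc (length V)             ≤⟨ s≤s (unique-length-≤ V (M₁ ++ M₂) uV (remove-v v∉V V⊆M)) ⟩
        suc (length (M₁ ++ M₂))    ≡⟨ cong suc (length-++ M₁) ⟩
        suc (length M₁ + length M₂) ≡⟨ +-suc (length M₁) (length M₂) ⟨
        length M₁ + length (v ∷ M₂) ≡⟨ length-++ M₁ ⟨
        length (M₁ ++ v ∷ M₂)      ∎
      where
      open ≤-Reasoning
      remove-v : ∀ {W} → All (v ≢_) W → All (_∈ M₁ ++ v ∷ M₂) W → All (_∈ M₁ ++ M₂) W
      remove-v [] [] = []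
      remove-v (v≢w ∷ ns) (w∈ ∷ ws) with ∈-++⁻ M₁ w∈
      ... | inj₁ w∈M₁ = ∈-++⁺ˡ w∈M₁ ∷ remove-v ns ws
      ... | inj₂ (here refl) = contradiction refl v≢w
      ... | inj₂ (there w∈M₂) = ∈-++⁺ʳ M₁ w∈M₂ ∷ remove-v ns ws

    unique-bounded : ∀ (V : List ℕ) p → Unique V → All (_< p) V → length V ≤ p
    unique-bounded V p uV V<p =
      subst (length V ≤_) (length-upTo p) (unique-length-≤ V (upTo p) uV (All.map ∈-upTo⁺ V<p))

  weight : {X : Set} → (X → ℕ) → List X → ℕ
  weight f xs = sum (map f xs)

  -- Given pairs (a_i , b_i) with f a_i ≢ f b_i, choosing one element from each
  -- pair attains at least min(p, k+1) distinct sums after k pairs; with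
  -- p - 1 pairs every residue is attained.
  module SubsetSums {X : Set} (f : X → ℕ) (p : ℕ) .{{_ : NonZero p}} (p-prime : Prime p) where
    open Congruence p

    Selection : (A B c u : List X) → Set
    Selection A B c u = (c ++ u ↭ A ++ B) × length c ≡ length A

    Attainable : List X → List X → ℕ → Set
    Attainable A B r = Σ (List X) λ c → Σ (List X) λ u → Selection A B c u × weight f c ≈ weight f A + r

    Incongruent : X → X → Set
    Incongruent a b = ¬ (f a ≈ f b)

    gap : X → X → ℕ
    gap a b = (f b + neg (f a)) % p

    gap-correct : ∀ a b → f a + gap a b ≈ f b
    gap-correct a b = begin
      f a + gap a b              ≈⟨ +-cong ≈-refl (%≈ _) ⟩
      f a + (f b + neg (f a))    ≡⟨ solve 3 (λ x y z → x :+ (y :+ z) := y :+ (x :+ z)) refl (f a) (f b) (neg (f a)) ⟩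
      f b + (f a + neg (f a))    ≈⟨ +-cong ≈-refl (+-neg (f a)) ⟩
      f b + 0                    ≡⟨ +-identityʳ (f b) ⟩
      f b                        ∎
      where open ≈-Reasoning

    gap-nonzero : ∀ {a b} → Incongruent a b → 0 < gap a b
    gap-nonzero {a} {b} a≉b with gap a b in eq
    ... | suc _ = s≤s z≤n
    ... | zero = contradiction (begin
      f a          ≡⟨ +-identityʳ (f a) ⟨
      f a + 0      ≡⟨ cong (f a +_) eq ⟨
      f a + gap a b ≈⟨ gap-correct a b ⟩
      f b          ∎) a≉b
      where open ≈-Reasoning

    attain-nothing : Attainable [] [] 0
    attain-nothing = [] , [] , (↭-refl , refl) , ≈-refl

    attain-first : ∀ {A B r} a b → Attainable A B r → Attainable (a ∷ A) (b ∷ B) r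
    attain-first {A} {B} {r} a b (c , u , (c++u↭ , |c|) , w) =
      a ∷ c , b ∷ u , (perm , cong suc |c|) , ≈-trans (+-cong ≈-refl w) (≡⇒≈ (sym (+-assoc (f a) (weight f A) r)))
      where
      perm : a ∷ c ++ b ∷ u ↭ a ∷ A ++ b ∷ B
      perm = prep a (↭-trans (shift b c u) (↭-trans (prep b c++u↭) (↭-sym (shift b A B))))

    shifted : X → X → ℕ → ℕ
    shifted a b r = (r + gap a b) % p

    attain-second : ∀ {A B r} a b → Attainable A B r → Attainable (a ∷ A) (b ∷ B) (shifted a b r)
    attain-second {A} {B} {r} a b (c , u , (c++u↭ , |c|) , w) =
      b ∷ c , a ∷ u , (perm , cong suc |c|) , weight-eq
      where
      perm : b ∷ c ++ a ∷ u ↭ a ∷ A ++ b ∷ B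
      perm = ↭-trans (prep b (shift a c u)) (↭-trans (swap b a c++u↭) (prep a (↭-sym (shift b A B))))
      weight-eq : f b + weight f c ≈ f a + weight f A + (r + gap a b) % p
      weight-eq = begin
        f b + weight f c                    ≈⟨ +-cong (≈-sym (gap-correct a b)) w ⟩
        f a + gap a b + (weight f A + r)    ≡⟨ solve 4 (λ x d s r → (x :+ d) :+ (s :+ r) := (x :+ s) :+ (r :+ d)) refl (f a) (gap a b) (weight f A) r ⟩
        f a + weight f A + (r + gap a b)    ≈⟨ +-cong ≈-refl (≈-sym (%≈ _)) ⟩
        f a + weight f A + (r + gap a b) % p ∎
        where open ≈-Reasoning

    inverse : ∀ d → 0 < d → d < p → ∃ λ e → e * d ≈ 1
    inverse d 0<d d<p with coprime-Bézout (Coprimality.sym (prime⇒coprime p-prime {{>-nonZero 0<d}} d<p))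
    ... | Bézout.+- x y eq = x , (begin
      x * d      ≡⟨ eq ⟨
      1 + y * p  ≈⟨ +-multiple 1 y ⟩
      1          ∎)
      where open ≈-Reasoning
    ... | Bézout.-+ x y eq = (p ∸ 1) * x , +-cancelʳ (p ∸ 1) (begin
      (p ∸ 1) * x * d + (p ∸ 1)    ≡⟨ solve 3 (λ q x d → q :* x :* d :+ q := q :* (con 1 :+ x :* d)) refl (p ∸ 1) x d ⟩
      (p ∸ 1) * (1 + x * d)        ≡⟨ cong ((p ∸ 1) *_) eq ⟩
      (p ∸ 1) * (y * p)            ≈⟨ *-cong (≈-refl {p ∸ 1}) (multiple≈0 y) ⟩
      (p ∸ 1) * 0                  ≡⟨ *-zeroʳ (p ∸ 1) ⟩
      0                            ≈⟨ ≈-sym p≈0 ⟩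
      p                            ≡⟨ trans (sym (m∸n+n≡m (>-nonZero⁻¹ p))) (+-comm (p ∸ 1) 1) ⟩
      1 + (p ∸ 1)                  ∎)
      where open ≈-Reasoning

    closed⇒complete : ∀ (L : List ℕ) d {x₀ t} → All (_< p) L → x₀ ∈ L →
      (∀ {x} → x ∈ L → (x + d) % p ∈ L) → 0 < d → d < p → t < p → t ∈ L
    closed⇒complete L d {x₀} {t} L<p x₀∈L closed 0<d d<p t<p =
      subst (_∈ L) (residue-≡ (m%n<n _ p) t<p lands-on-t) (orbit j)
      where
      orbit : ∀ j → (x₀ + j * d) % p ∈ L
      orbit zero = subst (_∈ L) (sym (trans (cong (_% p) (+-identityʳ x₀)) (m<n⇒m%n≡m (All.lookup L<p x₀∈L)))) x₀∈L
      orbit (suc j) = subst (_∈ L) (≈eq step) (closed (orbit j))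
        where
        step : (x₀ + j * d) % p + d ≈ x₀ + suc j * d
        step = ≈-trans (+-cong (%≈ _) ≈-refl) (≡⇒≈ (solve 3 (λ x j d → x :+ j :* d :+ d := x :+ (con 1 :+ j) :* d) refl x₀ j d))
      e = proj₁ (inverse d 0<d d<p)
      j = e * (t + neg x₀)
      lands-on-t : (x₀ + j * d) % p ≈ t
      lands-on-t = begin
        (x₀ + j * d) % p              ≈⟨ %≈ _ ⟩
        x₀ + j * d                    ≡⟨ solve 4 (λ x e s d → x :+ e :* s :* d := x :+ s :* (e :* d)) refl x₀ e (t + neg x₀) d ⟩
        x₀ + (t + neg x₀) * (e * d)   ≈⟨ +-cong (≈-refl {x₀}) (*-cong (≈-refl {t + neg x₀}) (proj₂ (inverse d 0<d d<p))) ⟩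
        x₀ + (t + neg x₀) * 1         ≡⟨ solve 3 (λ x t n → x :+ (t :+ n) :* con 1 := t :+ (x :+ n)) refl x₀ t (neg x₀) ⟩
        t + (x₀ + neg x₀)             ≈⟨ +-cong ≈-refl (+-neg x₀) ⟩
        t + 0                         ≡⟨ +-identityʳ t ⟩
        t                             ∎
        where open ≈-Reasoning

    -- Invariant of the covering argument for a target t: either t is attainable,
    -- or |A| + 1 distinct residues other than t are attainable.
    Progress : List X → List X → ℕ → Set
    Progress A B t = Attainable A B t ⊎ Σ (List ℕ) λ L →
      length L ≡ suc (length A) × Unique (t ∷ L) × All (λ r → r < p × Attainable A B r) L

    -- one more incongruent pair either reaches t or enlarges the attainable set
    -- (if the set were closed under the shift it would be everything, t included)
    progress-step : ∀ {A B t} a b → Incongruent a b → t < p → Progress A B t → Progress (a ∷ A) (b ∷ B) t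
    progress-step a b _ _ (inj₁ att) = inj₁ (attain-first a b att)
    progress-step {A} {B} {t} a b a≉b t<p (inj₂ (L , |L| , t∉L ∷ uL , good))
      with any? (λ r → shifted a b r ≟ t) L
    ... | yes hit =
      let r , r∈L , r↦t = find hit in
      inj₁ (subst (Attainable (a ∷ A) (b ∷ B)) r↦t (attain-second a b (proj₂ (All.lookup good r∈L))))
    ... | no miss with any? (λ r → ¬? (shifted a b r ∈? L)) L
    ...   | yes new =
      let r , r∈L , r′∉L = find new in
      inj₂ ( shifted a b r ∷ L , cong suc |L|
           , ((λ t≡r′ → miss (lose r∈L (sym t≡r′))) ∷ t∉L) ∷ (¬Any⇒All¬ L r′∉L ∷ uL)
           , (m%n<n _ p , attain-second a b (proj₂ (All.lookup good r∈L)))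
             ∷ All.map (λ (r<p , att) → r<p , attain-first a b att) good )
    ...   | no closed with L | |L|
    ...     | x₀ ∷ L′ | _ =
      contradiction
        (closed⇒complete (x₀ ∷ L′) (gap a b) (All.map proj₁ good) (here refl)
          (λ x∈L → decidable-stable (shifted a b _ ∈? _) (λ r′∉L → closed (lose x∈L r′∉L)))
          (gap-nonzero a≉b) (m%n<n _ p) t<p)
        (Unique[x∷xs]⇒x∉xs (t∉L ∷ uL))

    progress : ∀ {A B} → Pointwise Incongruent A B → ∀ {t} → t < p → Progress A B t
    progress [] {t} _ with t ≟ 0
    ... | yes refl = inj₁ attain-nothing
    ... | no t≢0 = inj₂ (0 ∷ [] , refl , (t≢0 ∷ []) ∷ ([] ∷ []) , (>-nonZero⁻¹ p , attain-nothing) ∷ [])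
    progress (a≉b ∷ pw) t<p = progress-step _ _ a≉b t<p (progress pw t<p)

    all-attainable : ∀ {A B} → Pointwise Incongruent A B → suc (length A) ≡ p → ∀ {t} → t < p → Attainable A B t
    all-attainable pw |A|+1≡p t<p with progress pw t<p
    ... | inj₁ att = att
    ... | inj₂ (L , |L| , uL , good) =
      contradiction (Pigeonhole.unique-bounded (_ ∷ L) p uL (t<p ∷ All.map proj₁ good))
                    (<⇒≱ (s≤s (≤-reflexive (trans (sym |A|+1≡p) (sym |L|)))))

module EGZForPrimes where

  open import Data.Nat
  open import Data.Nat.Properties
  open import Data.Nat.DivMod
  open import Data.Nat.Divisibility using (_∣_)
  open import Data.Nat.Primality using (Prime)
  open import Data.List using (List; []; _∷_; _++_; length; map)
  open import Data.List.Properties using (length-++; ++-assoc)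
  open import Data.List.Relation.Unary.All as All using (All; []; _∷_)
  open import Data.List.Relation.Unary.All.Properties using (++⁻ˡ)
  open import Data.List.Relation.Unary.AllPairs using (AllPairs; []; _∷_)
  open import Data.List.Relation.Binary.Pointwise using (Pointwise; []; _∷_)
  open import Data.List.Relation.Binary.Permutation.Propositional using (_↭_; prep; swap; ↭-trans; ↭-sym; ↭-refl; ↭-reflexive; module PermutationReasoning)
  open import Data.List.Relation.Binary.Permutation.Propositional.Properties using (shift; shifts; ++⁺ʳ; ↭-length; All-resp-↭)
  open import Data.List.Membership.Propositional.Properties using (∈-++⁺ʳ)
  open import Data.List.Relation.Unary.Any using (here)
  open import Data.Product using (Σ; _×_; _,_)
  open import Data.Sum using (_⊎_; inj₁; inj₂)
  open import Relation.Nullary using (yes; no)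
  open import Relation.Binary.PropositionalEquality
  open import Data.Nat.Solver using (module +-*-Solver)
  open +-*-Solver
  open ModularArithmetic
  open Covering

  ZeroSumPick : {X : Set} → (X → ℕ) → ℕ → List X → Set
  ZeroSumPick {X} f n xs = Σ (List X) λ ys → Σ (List X) λ zs →
    (ys ++ zs ↭ xs) × length ys ≡ n × n ∣ weight f ys

  pick-resp-↭ : ∀ {X : Set} {f : X → ℕ} {n xs xs′} → xs ↭ xs′ → ZeroSumPick f n xs → ZeroSumPick f n xs′
  pick-resp-↭ xs↭xs′ (ys , zs , ys++zs↭xs , |ys| , n∣) = ys , zs , ↭-trans ys++zs↭xs xs↭xs′ , |ys| , n∣

  EGZ : ℕ → Set₁
  EGZ n = ∀ {X : Set} (f : X → ℕ) (xs : List X) → n + (n ∸ 1) ≤ length xs → ZeroSumPick f n xs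

  take-prefix : ∀ {X : Set} n k (xs : List X) → n + k ≤ length xs →
    Σ (List X) λ A → Σ (List X) λ R → xs ≡ A ++ R × length A ≡ n × k ≤ length R
  take-prefix zero k xs k≤ = [] , xs , refl , refl , k≤
  take-prefix (suc n) k (x ∷ xs) (s≤s n+k≤) with take-prefix n k xs n+k≤
  ... | A , R , refl , refl , k≤ = x ∷ A , R , refl , refl , k≤

  three-blocks : ∀ {X : Set} q (s : List X) → suc q + q ≤ length s →
    Σ (List X) λ A → Σ (List X) λ B → Σ X λ z → Σ (List X) λ R →
      s ≡ A ++ B ++ z ∷ R × length A ≡ q × length B ≡ q
  three-blocks q s long with take-prefix q (suc q) s (subst (_≤ length s) (+-comm (suc q) q) long)
  ... | A , S , refl , |A| , q<|S| with take-prefix q 1 S (subst (_≤ length S) (+-comm 1 q) q<|S|)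
  ... | B , z ∷ R , refl , |B| , _ = A , B , z , R , refl , |A| , |B|

  module SortByKey {X : Set} (key : X → ℕ) where

    Sorted : List X → Set
    Sorted = AllPairs (λ x y → key x ≤ key y)

    insert : X → List X → List X
    insert x [] = x ∷ []
    insert x (y ∷ ys) with key x ≤? key y
    ... | yes _ = x ∷ y ∷ ys
    ... | no _ = y ∷ insert x ys

    insert-↭ : ∀ x ys → insert x ys ↭ x ∷ ys
    insert-↭ x [] = ↭-refl
    insert-↭ x (y ∷ ys) with key x ≤? key y
    ... | yes _ = ↭-refl
    ... | no _ = ↭-trans (prep y (insert-↭ x ys)) (swap y x ↭-refl)

    insert-sorted : ∀ x ys → Sorted ys → Sorted (insert x ys)
    insert-sorted x [] [] = [] ∷ []
    insert-sorted x (y ∷ ys) (y≤ys ∷ sorted) with key x ≤? key y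
    ... | yes x≤y = (x≤y ∷ All.map (≤-trans x≤y) y≤ys) ∷ y≤ys ∷ sorted
    ... | no x≰y = All-resp-↭ (↭-sym (insert-↭ x ys)) (≰⇒≥ x≰y ∷ y≤ys) ∷ insert-sorted x ys sorted

    sort : List X → List X
    sort [] = []
    sort (x ∷ xs) = insert x (sort xs)

    sort-↭ : ∀ xs → sort xs ↭ xs
    sort-↭ [] = ↭-refl
    sort-↭ (x ∷ xs) = ↭-trans (insert-↭ x (sort xs)) (prep x (sort-↭ xs))

    sort-sorted : ∀ xs → Sorted (sort xs)
    sort-sorted [] = []
    sort-sorted (x ∷ xs) = insert-sorted x (sort xs) (sort-sorted xs)

    constant-between : ∀ P a M b W → Sorted (P ++ a ∷ M ++ b ∷ W) → key a ≡ key b →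
      All (λ y → key y ≡ key a) (a ∷ M ++ b ∷ [])
    constant-between (_ ∷ P) a M b W (_ ∷ sorted) ka≡kb = constant-between P a M b W sorted ka≡kb
    constant-between [] a M b W (a≤ ∷ sorted) ka≡kb = refl ∷ squeeze M (++⁻ˡ M a≤) (below-b M sorted)
      where
      below-b : ∀ M′ → Sorted (M′ ++ b ∷ W) → All (λ m → key m ≤ key b) M′
      below-b [] _ = []
      below-b (m ∷ M′) (m≤ ∷ sorted′) = All.lookup m≤ (∈-++⁺ʳ M′ (here refl)) ∷ below-b M′ sorted′
      squeeze : ∀ M′ → All (λ m → key a ≤ key m) M′ → All (λ m → key m ≤ key b) M′ →
        All (λ y → key y ≡ key a) (M′ ++ b ∷ [])
      squeeze [] [] [] = sym ka≡kb ∷ []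
      squeeze (m ∷ M′) (a≤m ∷ ≥s) (m≤b ∷ ≤s) =
        ≤-antisym (≤-trans m≤b (≤-reflexive (sym ka≡kb))) a≤m ∷ squeeze M′ ≥s ≤s

  -- The EGZ theorem for a prime p = q + 1, following the classical argument:
  -- sort the items by residue and pair the i-th with the (i+q)-th.  If some pair
  -- is congruent, the q + 1 items between them are all congruent and sum to 0;
  -- otherwise the q incongruent pairs attain every residue (SubsetSums), and one
  -- more item completes a zero sum.
  module PrimeEGZ {X : Set} (f : X → ℕ) (q : ℕ) (p-prime : Prime (suc q)) where
    p = suc q
    open Congruence p
    open SubsetSums f p p-prime

    key : X → ℕ
    key x = f x % p
    open SortByKey key

    constant-weight : ∀ ys c → All (λ y → key y ≡ c) ys → weight f ys ≈ length ys * c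
    constant-weight [] c [] = ≈-refl
    constant-weight (y ∷ ys) c (ky≡c ∷ kys≡c) =
      +-cong (≈-trans (≈-sym (%≈ (f y))) (≡⇒≈ ky≡c)) (constant-weight ys c kys≡c)

    PairComparison : List X → List X → Set
    PairComparison A B = Pointwise Incongruent A B ⊎
      Σ (List X) λ A₁ → Σ X λ a → Σ (List X) λ A₂ → Σ (List X) λ B₁ → Σ X λ b → Σ (List X) λ B₂ →
        A ≡ A₁ ++ a ∷ A₂ × B ≡ B₁ ++ b ∷ B₂ × length A₁ ≡ length B₁ × key a ≡ key b

    aligned-pairs : ∀ (A B : List X) → length A ≡ length B → PairComparison A B
    aligned-pairs [] [] _ = inj₁ []
    aligned-pairs (a ∷ A) (b ∷ B) |aA|≡|bB| with key a ≟ key b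
    ... | yes ka≡kb = inj₂ ([] , a , A , [] , b , B , refl , refl , refl , ka≡kb)
    ... | no ka≢kb with aligned-pairs A B (suc-injective |aA|≡|bB|)
    ...   | inj₁ pw = inj₁ ((λ a≈b → ka≢kb (≈eq a≈b)) ∷ pw)
    ...   | inj₂ (A₁ , a′ , A₂ , B₁ , b′ , B₂ , refl , refl , |A₁|≡|B₁| , ka′≡kb′) =
      inj₂ (a ∷ A₁ , a′ , A₂ , b ∷ B₁ , b′ , B₂ , refl , refl , cong suc |A₁|≡|B₁| , ka′≡kb′)

    window-case : ∀ P a M b W → Sorted (P ++ a ∷ M ++ b ∷ W) → key a ≡ key b →
      length (a ∷ M ++ b ∷ []) ≡ p → ZeroSumPick f p (P ++ a ∷ M ++ b ∷ W)
    window-case P a M b W sorted ka≡kb |window| = window , P ++ W , perm , |window| , ≈0⇒∣ zero-sum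
      where
      window = a ∷ M ++ b ∷ []
      perm : window ++ P ++ W ↭ P ++ a ∷ M ++ b ∷ W
      perm = ↭-trans (shifts window P) (↭-reflexive (cong (λ l → P ++ a ∷ l) (++-assoc M (b ∷ []) W)))
      zero-sum : weight f window ≈ 0
      zero-sum = begin
        weight f window       ≈⟨ constant-weight window (key a) (constant-between P a M b W sorted ka≡kb) ⟩
        length window * key a ≡⟨ cong (_* key a) |window| ⟩
        p * key a             ≡⟨ *-comm p (key a) ⟩
        key a * p             ≈⟨ multiple≈0 (key a) ⟩
        0                     ∎
        where open ≈-Reasoning

    -- the congruent aligned pair a = A[i], b = B[i] spans a window of p items
    aligned-case : ∀ A₁ a A₂ B₁ b B₂ T → Sorted ((A₁ ++ a ∷ A₂) ++ (B₁ ++ b ∷ B₂) ++ T) →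
      length A₁ ≡ length B₁ → key a ≡ key b → length (A₁ ++ a ∷ A₂) ≡ q →
      ZeroSumPick f p ((A₁ ++ a ∷ A₂) ++ (B₁ ++ b ∷ B₂) ++ T)
    aligned-case A₁ a A₂ B₁ b B₂ T sorted |A₁|≡|B₁| ka≡kb |A| =
      subst (ZeroSumPick f p) (sym regroup)
        (window-case A₁ a (A₂ ++ B₁) b (B₂ ++ T) (subst Sorted regroup sorted) ka≡kb |window|)
      where
      regroup : (A₁ ++ a ∷ A₂) ++ (B₁ ++ b ∷ B₂) ++ T ≡ A₁ ++ a ∷ (A₂ ++ B₁) ++ b ∷ (B₂ ++ T)
      regroup = begin
        (A₁ ++ a ∷ A₂) ++ (B₁ ++ b ∷ B₂) ++ T  ≡⟨ ++-assoc A₁ (a ∷ A₂) _ ⟩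
        A₁ ++ a ∷ A₂ ++ (B₁ ++ b ∷ B₂) ++ T    ≡⟨ cong (λ l → A₁ ++ a ∷ A₂ ++ l) (++-assoc B₁ (b ∷ B₂) T) ⟩
        A₁ ++ a ∷ A₂ ++ B₁ ++ b ∷ B₂ ++ T     ≡⟨ cong (λ l → A₁ ++ a ∷ l) (++-assoc A₂ B₁ _) ⟨
        A₁ ++ a ∷ (A₂ ++ B₁) ++ b ∷ (B₂ ++ T) ∎
        where open ≡-Reasoning
      |window| : length (a ∷ (A₂ ++ B₁) ++ b ∷ []) ≡ p
      |window| = cong suc (begin
        length ((A₂ ++ B₁) ++ b ∷ [])        ≡⟨ length-++ (A₂ ++ B₁) ⟩
        length (A₂ ++ B₁) + 1               ≡⟨ cong (_+ 1) (length-++ A₂) ⟩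
        length A₂ + length B₁ + 1           ≡⟨ cong (λ l → length A₂ + l + 1) (sym |A₁|≡|B₁|) ⟩
        length A₂ + length A₁ + 1           ≡⟨ solve 2 (λ x y → x :+ y :+ con 1 := y :+ (con 1 :+ x)) refl (length A₂) (length A₁) ⟩
        length A₁ + length (a ∷ A₂)         ≡⟨ length-++ A₁ ⟨
        length (A₁ ++ a ∷ A₂)               ≡⟨ |A| ⟩
        q                                   ∎)
        where open ≡-Reasoning

    -- q incongruent pairs and one more item z: choose from the pairs to cancel z
    covering-case : ∀ A B z R → Pointwise Incongruent A B → length A ≡ q → ZeroSumPick f p (A ++ B ++ z ∷ R)
    covering-case A B z R pw |A| = complete (all-attainable pw (cong suc |A|) (m%n<n target p))
      where
      target = neg (weight f A + f z)
      complete : Attainable A B (target % p) → ZeroSumPick f p (A ++ B ++ z ∷ R)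
      complete (c , u , (c++u↭A++B , |c|) , wc) = z ∷ c , u ++ R , perm , cong suc (trans |c| |A|) , ≈0⇒∣ zero-sum
        where
        perm : z ∷ c ++ u ++ R ↭ A ++ B ++ z ∷ R
        perm = begin
          z ∷ c ++ u ++ R      ≡⟨ cong (z ∷_) (++-assoc c u R) ⟨
          z ∷ (c ++ u) ++ R    ↭⟨ prep z (++⁺ʳ R c++u↭A++B) ⟩
          z ∷ (A ++ B) ++ R    ↭⟨ shift z (A ++ B) R ⟨
          (A ++ B) ++ z ∷ R    ≡⟨ ++-assoc A B (z ∷ R) ⟩
          A ++ B ++ z ∷ R      ∎
          where open PermutationReasoning
        zero-sum : f z + weight f c ≈ 0
        zero-sum = begin
          f z + weight f c                     ≈⟨ +-cong ≈-refl wc ⟩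
          f z + (weight f A + target % p)      ≈⟨ +-cong (≈-refl {f z}) (+-cong ≈-refl (%≈ target)) ⟩
          f z + (weight f A + target)          ≡⟨ solve 3 (λ z a t → z :+ (a :+ t) := a :+ z :+ t) refl (f z) (weight f A) target ⟩
          weight f A + f z + target            ≈⟨ +-neg (weight f A + f z) ⟩
          0                                    ∎
          where open ≈-Reasoning

    pick : ∀ xs → p + (p ∸ 1) ≤ length xs → ZeroSumPick f p xs
    pick xs long
      with three-blocks q (sort xs) (subst (p + q ≤_) (sym (↭-length (sort-↭ xs))) long)
    ... | A , B , z , R , sorted≡ , |A| , |B| =
      pick-resp-↭ (sort-↭ xs) (subst (ZeroSumPick f p) (sym sorted≡) (by-pairs (aligned-pairs A B (trans |A| (sym |B|)))))
      where
      by-pairs : PairComparison A B → ZeroSumPick f p (A ++ B ++ z ∷ R)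
      by-pairs (inj₁ pw) = covering-case A B z R pw |A|
      by-pairs (inj₂ (A₁ , a , A₂ , B₁ , b , B₂ , refl , refl , |A₁|≡|B₁| , ka≡kb)) =
        aligned-case A₁ a A₂ B₁ b B₂ (z ∷ R) (subst Sorted sorted≡ (sort-sorted xs)) |A₁|≡|B₁| ka≡kb |A|

  egz-prime : ∀ q → Prime (suc q) → EGZ (suc q)
  egz-prime q p-prime f = PrimeEGZ.pick f q p-prime

module EGZTheorem where

  open import Data.Nat
  open import Data.Nat.Properties
  open import Data.Nat.DivMod
  open import Data.Nat.Divisibility using (_∣_; *-monoʳ-∣; 1∣_)
  open import Data.Nat.Primality using (Prime; prime⇒nonZero; productOfPrimes≥1)
  open import Data.Nat.Primality.Factorisation using (factorise)
  open import Data.Nat.ListAction using (sum; product)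
  open import Data.Nat.ListAction.Properties using (sum-++)
  open import Data.List using (List; []; _∷_; _++_; length; map; concat)
  open import Data.List.Properties using (length-++; ++-assoc; concat-++; map-++)
  open import Data.List.Relation.Unary.All as All using (All; []; _∷_)
  open import Data.List.Relation.Unary.All.Properties using (++⁻ˡ)
  open import Data.List.Relation.Binary.Permutation.Propositional using (_↭_; prep; swap; ↭-trans; ↭-sym; ↭-refl; ↭-reflexive; module PermutationReasoning) renaming (refl to ↭-refl′; trans to ↭-trans′)
  open import Data.List.Relation.Binary.Permutation.Propositional.Properties using (shifts; ++⁺ˡ; ++⁺ʳ; ↭-length; All-resp-↭)
  open import Data.Product using (Σ; _×_; _,_)
  open import Relation.Nullary using (contradiction)
  open import Relation.Binary.PropositionalEquality
  open import Data.Nat.Solver using (module +-*-Solver)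
  open +-*-Solver
  open ModularArithmetic
  open Covering
  open EGZForPrimes

  concat-↭ : ∀ {X : Set} {xss yss : List (List X)} → xss ↭ yss → concat xss ↭ concat yss
  concat-↭ ↭-refl′ = ↭-refl
  concat-↭ (prep xs xss↭yss) = ++⁺ˡ xs (concat-↭ xss↭yss)
  concat-↭ (swap xs ys xss↭yss) = ↭-trans (shifts xs ys) (++⁺ˡ ys (++⁺ˡ xs (concat-↭ xss↭yss)))
  concat-↭ (↭-trans′ p q) = ↭-trans (concat-↭ p) (concat-↭ q)

  egz-1 : EGZ 1
  egz-1 f (x ∷ xs) _ = x ∷ [] , xs , ↭-refl , refl , 1∣ _

  -- EGZ is multiplicative: extract 2k - 1 disjoint zero-sum blocks of size m
  -- using EGZ m, then apply EGZ k to the blocks weighted by weight / m.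
  module Multiplicative (m′ k′ : ℕ) (egz-m : EGZ (suc m′)) (egz-k : EGZ (suc k′)) where
    m = suc m′
    k = suc k′

    module _ {X : Set} (f : X → ℕ) where

      Block : List X → Set
      Block B = length B ≡ m × m ∣ weight f B

      extract-blocks : ∀ j xs → j * m + m′ ≤ length xs →
        Σ (List (List X)) λ Bs → Σ (List X) λ R → length Bs ≡ j × All Block Bs × (concat Bs ++ R ↭ xs)
      extract-blocks zero xs _ = [] , xs , refl , [] , ↭-refl
      extract-blocks (suc j) xs long
        with egz-m f xs (≤-trans (+-monoʳ-≤ m (m≤n+m m′ (j * m))) (≤-trans (≤-reflexive (sym (+-assoc m (j * m) m′))) long))
      ... | B , rest , B++rest↭xs , |B| , m∣ with extract-blocks j rest rest-long
        where
        |xs| : length xs ≡ m + length rest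
        |xs| = trans (sym (↭-length B++rest↭xs)) (trans (length-++ B) (cong (_+ length rest) |B|))
        rest-long : j * m + m′ ≤ length rest
        rest-long = +-cancelˡ-≤ m _ _ (subst (m + (j * m + m′) ≤_) |xs| (≤-trans (≤-reflexive (sym (+-assoc m (j * m) m′))) long))
      ... | Bs , R , |Bs| , blocks , Bs++R↭rest =
        B ∷ Bs , R , cong suc |Bs| , (|B| , m∣) ∷ blocks ,
        ↭-trans (↭-reflexive (++-assoc B (concat Bs) R)) (↭-trans (++⁺ˡ B Bs++R↭rest) B++rest↭xs)

      reduced : List X → ℕ
      reduced B = weight f B / m

      length-concat : ∀ Cs → All Block Cs → length (concat Cs) ≡ length Cs * m
      length-concat [] [] = refl
      length-concat (C ∷ Cs) ((|C| , _) ∷ blocks) = trans (length-++ C) (cong₂ _+_ |C| (length-concat Cs blocks))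

      weight-concat : ∀ Cs → All Block Cs → weight f (concat Cs) ≡ m * weight reduced Cs
      weight-concat [] [] = sym (*-zeroʳ m)
      weight-concat (C ∷ Cs) ((_ , m∣) ∷ blocks) = begin
        weight f (C ++ concat Cs)                   ≡⟨ cong sum (map-++ f C (concat Cs)) ⟩
        sum (map f C ++ map f (concat Cs))          ≡⟨ sum-++ (map f C) _ ⟩
        weight f C + weight f (concat Cs)           ≡⟨ cong₂ _+_ (sym (m*[n/m]≡n m∣)) (weight-concat Cs blocks) ⟩
        m * reduced C + m * weight reduced Cs       ≡⟨ *-distribˡ-+ m (reduced C) _ ⟨
        m * weight reduced (C ∷ Cs)                 ∎
        where open ≡-Reasoning

      combine-blocks : ∀ Bs R xs → length Bs ≡ k + k′ → All Block Bs → concat Bs ++ R ↭ xs →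
        ZeroSumPick f (m * k) xs
      combine-blocks Bs R xs |Bs| blocks Bs++R↭xs = from-pick (egz-k reduced Bs (≤-reflexive (sym |Bs|)))
        where
        from-pick : ZeroSumPick reduced k Bs → ZeroSumPick f (m * k) xs
        from-pick (Cs , Ds , Cs++Ds↭Bs , |Cs| , k∣) = concat Cs , concat Ds ++ R , perm , |concat-Cs| , mk∣
          where
          Cs-blocks : All Block Cs
          Cs-blocks = ++⁻ˡ Cs (All-resp-↭ (↭-sym Cs++Ds↭Bs) blocks)
          perm : concat Cs ++ concat Ds ++ R ↭ xs
          perm = begin
            concat Cs ++ concat Ds ++ R    ≡⟨ ++-assoc (concat Cs) (concat Ds) R ⟨
            (concat Cs ++ concat Ds) ++ R  ≡⟨ cong (_++ R) (concat-++ Cs Ds) ⟩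
            concat (Cs ++ Ds) ++ R         ↭⟨ ++⁺ʳ R (concat-↭ Cs++Ds↭Bs) ⟩
            concat Bs ++ R                 ↭⟨ Bs++R↭xs ⟩
            xs                             ∎
            where open PermutationReasoning
          |concat-Cs| : length (concat Cs) ≡ m * k
          |concat-Cs| = trans (length-concat Cs Cs-blocks) (trans (cong (_* m) |Cs|) (*-comm k m))
          mk∣ : m * k ∣ weight f (concat Cs)
          mk∣ = subst (m * k ∣_) (sym (weight-concat Cs Cs-blocks)) (*-monoʳ-∣ m k∣)

      block-count : m * k + (m * k ∸ 1) ≡ (k + k′) * m + m′
      block-count = solve 2 (λ m′ k′ → (con 1 :+ m′) :* (con 1 :+ k′) :+ (k′ :+ m′ :* (con 1 :+ k′))
                                     := ((con 1 :+ k′) :+ k′) :* (con 1 :+ m′) :+ m′) refl m′ k′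

      egz-product : ∀ xs → m * k + (m * k ∸ 1) ≤ length xs → ZeroSumPick f (m * k) xs
      egz-product xs long =
        let Bs , R , |Bs| , blocks , Bs++R↭xs = extract-blocks (k + k′) xs (subst (_≤ length xs) block-count long)
        in combine-blocks Bs R xs |Bs| blocks Bs++R↭xs

    egz-mul : EGZ (m * k)
    egz-mul = egz-product

  egz-product-of-primes : ∀ ps → All Prime ps → EGZ (product ps)
  egz-product-of-primes [] [] = egz-1
  egz-product-of-primes (zero ∷ _) (0-prime ∷ _) = contradiction (prime⇒nonZero 0-prime) λ ()
  egz-product-of-primes (suc q ∷ ps) (p-prime ∷ primes)
    with product ps | productOfPrimes≥1 primes | egz-product-of-primes ps primes
  ... | suc k′ | _ | egz-k = Multiplicative.egz-mul q k′ (egz-prime q p-prime) egz-k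

  egz : ∀ n → .{{NonZero n}} → EGZ n
  egz n with factorise n
  ... | record { factors = ps ; isFactorisation = n≡∏ps ; factorsPrime = primes } =
    subst EGZ (sym n≡∏ps) (egz-product-of-primes ps primes)

-- Multiplicity vectors (the representation of sequences in Defs) versus
-- lists of group elements, on which the EGZ theorem is stated.
module Multiplicities where

  open import Data.Nat
  open import Data.Nat.Properties
  open import Data.Fin using (Fin; zero; suc; toℕ)
  open import Data.Vec using ([]; _∷_; replicate; zipWith)
  open import Data.Vec.Relation.Binary.Pointwise.Inductive using ([]; _∷_)
  open import Data.List using (List; []; _∷_; _++_; length; map)
  import Data.List as List
  open import Data.List.Properties using (length-++; length-replicate; length-map)
  open import Data.List.Relation.Binary.Permutation.Propositional using (_↭_; prep; swap) renaming (refl to ↭-refl′; trans to ↭-trans′)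
  open import Relation.Binary.PropositionalEquality
  open import Data.Nat.Solver using (module +-*-Solver)
  open +-*-Solver
  open Covering using (weight)

  infixl 6 _⊕_
  _⊕_ : ∀ {n} → Seq n → Seq n → Seq n
  _⊕_ = zipWith _+_

  ⊕-comm : ∀ {n} (u v : Seq n) → u ⊕ v ≡ v ⊕ u
  ⊕-comm [] [] = refl
  ⊕-comm (a ∷ u) (b ∷ v) = cong₂ _∷_ (+-comm a b) (⊕-comm u v)

  ⊕-assoc : ∀ {n} (u v w : Seq n) → (u ⊕ v) ⊕ w ≡ u ⊕ (v ⊕ w)
  ⊕-assoc [] [] [] = refl
  ⊕-assoc (a ∷ u) (b ∷ v) (c ∷ w) = cong₂ _∷_ (+-assoc a b c) (⊕-assoc u v w)

  empty : ∀ n → Seq n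
  empty n = replicate n 0

  empty-⊕ : ∀ {n} (v : Seq n) → empty n ⊕ v ≡ v
  empty-⊕ [] = refl
  empty-⊕ (a ∷ v) = cong (a ∷_) (empty-⊕ v)

  single : ∀ {n} → Fin n → Seq n
  single {suc n} zero = 1 ∷ empty n
  single {suc n} (suc g) = 0 ∷ single g

  ⊑-⊕ : ∀ {n} (u v : Seq n) → u ⊑ (u ⊕ v)
  ⊑-⊕ [] [] = []
  ⊑-⊕ (a ∷ u) (b ∷ v) = m≤m+n a b ∷ ⊑-⊕ u v

  len-⊕ : ∀ {n} (u v : Seq n) → len (u ⊕ v) ≡ len u + len v
  len-⊕ [] [] = refl
  len-⊕ (a ∷ u) (b ∷ v) = trans (cong (a + b +_) (len-⊕ u v))
    (solve 4 (λ a b x y → a :+ b :+ (x :+ y) := a :+ x :+ (b :+ y)) refl a b (len u) (len v))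

  len-empty : ∀ n → len (empty n) ≡ 0
  len-empty zero = refl
  len-empty (suc n) = len-empty n

  len-single : ∀ {n} (g : Fin n) → len (single g) ≡ 1
  len-single {suc n} zero = cong suc (len-empty n)
  len-single {suc n} (suc g) = len-single g

  σ-from : ∀ {n} → ℕ → Seq n → ℕ
  σ-from k [] = 0
  σ-from k (c ∷ v) = k * c + σ-from (suc k) v

  σ≡σ-from : ∀ {n} (v : Seq n) → σ v ≡ σ-from 0 v
  σ≡σ-from v = go 0 (λ i → i) (λ i → refl) v
    where
    go : ∀ {n m} k (h : Fin n → Fin m) → (∀ i → toℕ (h i) ≡ k + toℕ i) → (v : Seq n) →
      Data.Vec.sum (zipWith (λ g c → toℕ g * c) (Data.Vec.tabulate h) v) ≡ σ-from k v
    go k h h≡ [] = refl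
    go k h h≡ (c ∷ v) = cong₂ _+_ (cong (_* c) (trans (h≡ zero) (+-identityʳ k)))
      (go (suc k) (λ i → h (suc i)) (λ i → trans (h≡ (suc i)) (+-suc k (toℕ i))) v)

  σ-from-⊕ : ∀ {n} k (u v : Seq n) → σ-from k (u ⊕ v) ≡ σ-from k u + σ-from k v
  σ-from-⊕ k [] [] = refl
  σ-from-⊕ k (a ∷ u) (b ∷ v) = trans (cong (k * (a + b) +_) (σ-from-⊕ (suc k) u v))
    (solve 5 (λ k a b x y → k :* (a :+ b) :+ (x :+ y) := k :* a :+ x :+ (k :* b :+ y))
      refl k a b (σ-from (suc k) u) (σ-from (suc k) v))

  σ-from-empty : ∀ n k → σ-from k (empty n) ≡ 0
  σ-from-empty zero k = refl
  σ-from-empty (suc n) k = cong₂ _+_ (*-zeroʳ k) (σ-from-empty n (suc k))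

  σ-from-single : ∀ {n} k (g : Fin n) → σ-from k (single g) ≡ k + toℕ g
  σ-from-single {suc n} k zero = cong₂ _+_ (*-identityʳ k) (σ-from-empty n (suc k))
  σ-from-single {suc n} k (suc g) = trans (cong₂ _+_ (*-zeroʳ k) (σ-from-single (suc k) g)) (sym (+-suc k (toℕ g)))

  count : ∀ {n} → List (Fin n) → Seq n
  count {n} [] = empty n
  count (y ∷ ys) = single y ⊕ count ys

  len-count : ∀ {n} (ys : List (Fin n)) → len (count ys) ≡ length ys
  len-count {n} [] = len-empty n
  len-count (y ∷ ys) = trans (len-⊕ (single y) (count ys)) (cong₂ _+_ (len-single y) (len-count ys))

  σ-count : ∀ {n} (ys : List (Fin n)) → σ (count ys) ≡ weight toℕ ys
  σ-count ys = trans (σ≡σ-from (count ys)) (go ys)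
    where
    go : ∀ {n} (ys : List (Fin n)) → σ-from 0 (count ys) ≡ weight toℕ ys
    go {n} [] = σ-from-empty n 0
    go (y ∷ ys) = trans (σ-from-⊕ 0 (single y) (count ys)) (cong₂ _+_ (σ-from-single 0 y) (go ys))

  count-++ : ∀ {n} (ys zs : List (Fin n)) → count (ys ++ zs) ≡ count ys ⊕ count zs
  count-++ [] zs = sym (empty-⊕ (count zs))
  count-++ (y ∷ ys) zs = trans (cong (single y ⊕_) (count-++ ys zs)) (sym (⊕-assoc (single y) (count ys) (count zs)))

  count-↭ : ∀ {n} {xs ys : List (Fin n)} → xs ↭ ys → count xs ≡ count ys
  count-↭ ↭-refl′ = refl
  count-↭ (prep x xs↭ys) = cong (single x ⊕_) (count-↭ xs↭ys)
  count-↭ (swap {xs} {ys} x y xs↭ys) = begin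
    single x ⊕ (single y ⊕ count xs)   ≡⟨ ⊕-assoc (single x) (single y) _ ⟨
    (single x ⊕ single y) ⊕ count xs   ≡⟨ cong₂ _⊕_ (⊕-comm (single x) (single y)) (count-↭ xs↭ys) ⟩
    (single y ⊕ single x) ⊕ count ys   ≡⟨ ⊕-assoc (single y) (single x) _ ⟩
    single y ⊕ (single x ⊕ count ys)   ∎
    where open ≡-Reasoning
  count-↭ (↭-trans′ p q) = trans (count-↭ p) (count-↭ q)

  expand : ∀ {n} → Seq n → List (Fin n)
  expand [] = []
  expand (c ∷ S) = List.replicate c zero ++ map suc (expand S)

  length-expand : ∀ {n} (S : Seq n) → length (expand S) ≡ len S
  length-expand [] = refl
  length-expand (c ∷ S) = trans (length-++ (List.replicate c zero))
    (cong₂ _+_ (length-replicate c) (trans (length-map suc (expand S)) (length-expand S)))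

  count-expand : ∀ {n} (S : Seq n) → count (expand S) ≡ S
  count-expand [] = refl
  count-expand {suc n} (c ∷ S) = begin
    count (List.replicate c zero ++ map suc (expand S))        ≡⟨ count-++ (List.replicate c zero) _ ⟩
    count (List.replicate c zero) ⊕ count (map suc (expand S)) ≡⟨ cong₂ _⊕_ (zeros c) (shifted (expand S)) ⟩
    (c ∷ empty n) ⊕ (0 ∷ count (expand S))                     ≡⟨ cong₂ _∷_ (+-identityʳ c) (empty-⊕ _) ⟩
    c ∷ count (expand S)                                       ≡⟨ cong (c ∷_) (count-expand S) ⟩
    c ∷ S                                                      ∎
    where
    open ≡-Reasoning
    zeros : ∀ c → count {suc n} (List.replicate c zero) ≡ c ∷ empty n
    zeros zero = refl
    zeros (suc c) = trans (cong (single zero ⊕_) (zeros c)) (cong (suc c ∷_) (empty-⊕ (empty n)))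
    shifted : ∀ (xs : List (Fin n)) → count (map suc xs) ≡ 0 ∷ count xs
    shifted [] = refl
    shifted (x ∷ xs) = cong (single (suc x) ⊕_) (shifted xs)

  count-⊑ : ∀ {n} (ys zs : List (Fin n)) (S : Seq n) → ys ++ zs ↭ expand S → count ys ⊑ S
  count-⊑ ys zs S ys++zs↭ =
    subst (count ys ⊑_) (trans (sym (count-++ ys zs)) (trans (count-↭ ys++zs↭) (count-expand S))) (⊑-⊕ (count ys) (count zs))

module ExceptionalSequence where

  open import Data.Nat
  open import Data.Nat.Properties
  open import Data.Nat.DivMod
  open import Data.Nat.Divisibility using (_∣_; divides; m%n≡0⇒n∣m; ∣⇒≤)
  open import Data.Fin using (Fin; zero; suc; toℕ; fromℕ<)
  open import Data.Fin.Properties using (toℕ-fromℕ<) renaming (_≟_ to _≟ᶠ_)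
  open import Data.Vec using ([]; _∷_; replicate; lookup)
  open import Data.Vec.Properties using (lookup-zipWith; lookup-replicate; ≡-dec)
  open import Data.Vec.Relation.Binary.Pointwise.Inductive using ([]; _∷_)
  open import Data.List using (List; []; _∷_; _++_; length)
  open import Data.List.Properties using (length-++)
  open import Data.Nat.ListAction.Properties using (sum-↭)
  open import Data.List.Membership.Propositional using (_∈_)
  open import Data.List.Membership.Propositional.Properties using (∈-∃++)
  open import Data.List.Relation.Unary.Any using (here; there)
  open import Data.List.Relation.Binary.Permutation.Propositional using (_↭_; prep; ↭-trans; ↭-sym; module PermutationReasoning)
  open import Data.List.Relation.Binary.Permutation.Propositional.Properties using (shift; shifts; ++⁺ʳ; ↭-length) renaming (map⁺ to ↭-map⁺)
  open import Data.Product using (Σ; _×_; _,_; proj₁; proj₂)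
  open import Relation.Nullary using (¬_; yes; no; contradiction)
  open import Relation.Nullary.Decidable using (True; toWitness)
  open import Relation.Unary using (Pred; _⊆_)
  open import Relation.Binary.PropositionalEquality
  open import Data.Nat.Solver using (module +-*-Solver)
  open +-*-Solver
  open ModularArithmetic
  open Covering using (weight)
  open EGZForPrimes using (ZeroSumPick)
  open EGZTheorem using (egz)
  open Multiplicities

  -- the sequence 0 · 1 · … · (n-1) using every element once
  all-once : ∀ n → Seq n
  all-once n = replicate n 1

  len-all-once : ∀ n → len (all-once n) ≡ n
  len-all-once zero = refl
  len-all-once (suc n) = cong suc (len-all-once n)

  gauss : ∀ m k → 2 * σ-from k (replicate m 1) + m ≡ m * (2 * k + m)
  gauss zero k = refl
  gauss (suc m) k = begin
    2 * (k * 1 + s) + suc m          ≡⟨ solve 3 (λ k s m → con 2 :* (k :* con 1 :+ s) :+ (con 1 :+ m) := con 2 :* k :+ con 1 :+ (con 2 :* s :+ m)) refl k s m ⟩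
    2 * k + 1 + (2 * s + m)          ≡⟨ cong (2 * k + 1 +_) (gauss m (suc k)) ⟩
    2 * k + 1 + m * (2 * suc k + m)  ≡⟨ solve 2 (λ k m → con 2 :* k :+ con 1 :+ m :* (con 2 :* (con 1 :+ k) :+ m) := (con 1 :+ m) :* (con 2 :* k :+ (con 1 :+ m))) refl k m ⟩
    suc m * (2 * k + suc m)          ∎
    where
    open ≡-Reasoning
    s = σ-from (suc k) (replicate m 1)

  odd⇒1+2h : ∀ n → ¬ (2 ∣ n) → n ≡ 1 + n / 2 * 2
  odd⇒1+2h n 2∤n with n % 2 in eq | m%n<n n 2
  ... | zero | _ = contradiction (m%n≡0⇒n∣m n 2 eq) 2∤n
  ... | suc zero | _ = trans (m≡m%n+[m/n]*n n 2) (cong (_+ n / 2 * 2) eq)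
  ... | suc (suc _) | s≤s (s≤s ())

  -- for odd n, 0 + 1 + … + (n-1) = n (n-1)/2 is a multiple of n
  all-once-zero-sum : ∀ n → ¬ (2 ∣ n) → n ∣ σ (all-once n)
  all-once-zero-sum n 2∤n = divides h (trans (σ≡σ-from (all-once n)) (*-cancelˡ-≡ _ _ 2 (+-cancelʳ-≡ n _ _ doubled)))
    where
    h = n / 2
    doubled : 2 * σ-from 0 (all-once n) + n ≡ 2 * (h * n) + n
    doubled = begin
      2 * σ-from 0 (all-once n) + n ≡⟨ gauss n 0 ⟩
      n * n                         ≡⟨ cong (n *_) (odd⇒1+2h n 2∤n) ⟩
      n * (1 + h * 2)               ≡⟨ solve 2 (λ n h → n :* (con 1 :+ h :* con 2) := con 2 :* (h :* n) :+ n) refl n h ⟩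
      2 * (h * n) + n               ∎
      where open ≡-Reasoning

  occ : ∀ {n} → List (Fin n) → Fin n → ℕ
  occ ys g = lookup (count ys) g

  occ-here : ∀ {n} (g : Fin n) ys → occ (g ∷ ys) g ≡ suc (occ ys g)
  occ-here g ys = trans (lookup-zipWith _+_ g (single g) (count ys)) (cong (_+ occ ys g) (single-here g))
    where
    single-here : ∀ {n} (g : Fin n) → lookup (single g) g ≡ 1
    single-here zero = refl
    single-here (suc g) = single-here g

  occ-there : ∀ {n} {y g : Fin n} ys → y ≢ g → occ (y ∷ ys) g ≡ occ ys g
  occ-there {y = y} {g} ys y≢g = trans (lookup-zipWith _+_ g (single y) (count ys)) (cong (_+ occ ys g) (single-elsewhere y g y≢g))
    where
    single-elsewhere : ∀ {n} (y g : Fin n) → y ≢ g → lookup (single y) g ≡ 0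
    single-elsewhere zero zero y≢g = contradiction refl y≢g
    single-elsewhere {suc n} zero (suc g) _ = lookup-replicate g 0
    single-elsewhere (suc y) zero _ = refl
    single-elsewhere (suc y) (suc g) y≢g = single-elsewhere y g (λ y≡g → y≢g (cong suc y≡g))

  occ-↭ : ∀ {n} {xs ys : List (Fin n)} g → xs ↭ ys → occ xs g ≡ occ ys g
  occ-↭ g xs↭ys = cong (λ v → lookup v g) (count-↭ xs↭ys)

  occurs⇒∈ : ∀ {n} (ys : List (Fin n)) g → 0 < occ ys g → g ∈ ys
  occurs⇒∈ {n} [] g 0<occ = contradiction (subst (0 <_) (lookup-replicate g 0) 0<occ) λ ()
  occurs⇒∈ (y ∷ ys) g 0<occ with y ≟ᶠ g
  ... | yes refl = here refl
  ... | no y≢g = there (occurs⇒∈ ys g (subst (0 <_) (occ-there ys y≢g) 0<occ))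

  bring-to-front : ∀ {X : Set} {a : X} {ys} → a ∈ ys → Σ (List X) λ ys₁ → ys ↭ a ∷ ys₁
  bring-to-front {a = a} a∈ys with ∈-∃++ a∈ys
  ... | ys₁ , ys₂ , refl = ys₁ ++ ys₂ , shift a ys₁ ys₂

  remove-two : ∀ {n} ys {a b : Fin n} → a ≢ b → count ys ≡ all-once n →
    Σ (List (Fin n)) λ ys₂ → (ys ↭ a ∷ b ∷ ys₂) × occ ys₂ a ≡ 0
  remove-two {n} ys {a} {b} a≢b ys-once = ys₂ , ys↭ , a-gone
    where
    once : ∀ g → occ ys g ≡ 1
    once g = trans (cong (λ v → lookup v g) ys-once) (lookup-replicate g 1)
    first = bring-to-front (occurs⇒∈ ys a (subst (0 <_) (sym (once a)) z<s))
    ys₁ = proj₁ first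
    b-once : occ ys₁ b ≡ 1
    b-once = trans (sym (occ-there ys₁ a≢b)) (trans (sym (occ-↭ b (proj₂ first))) (once b))
    second = bring-to-front (occurs⇒∈ ys₁ b (subst (0 <_) (sym b-once) z<s))
    ys₂ = proj₁ second
    ys↭ : ys ↭ a ∷ b ∷ ys₂
    ys↭ = ↭-trans (proj₂ first) (prep a (proj₂ second))
    a-gone : occ ys₂ a ≡ 0
    a-gone = suc-injective (begin
      suc (occ ys₂ a)          ≡⟨ cong suc (occ-there ys₂ (λ b≡a → a≢b (sym b≡a))) ⟨
      suc (occ (b ∷ ys₂) a)    ≡⟨ occ-here a (b ∷ ys₂) ⟨
      occ (a ∷ b ∷ ys₂) a      ≡⟨ occ-↭ a ys↭ ⟨
      occ ys a                 ≡⟨ once a ⟩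
      1                        ∎)
      where open ≡-Reasoning

  Ω₁ : (n : ℕ) → Pred (Seq n) 0ℓ
  Ω₁ n T = Omega n T × T ≢ all-once n

  count-∈Ω : ∀ {n} (ys : List (Fin (suc n))) → length ys ≡ suc n → suc n ∣ weight toℕ ys → Omega (suc n) (count ys)
  count-∈Ω {n} ys |ys| n∣ = ((subst (0 <_) (sym (trans (len-count ys) |ys|)) z<s) , subst (suc n ∣_) (sym (σ-count ys)) n∣) , trans (len-count ys) |ys|

  all-once∈Ω : ∀ n → 0 < n → ¬ (2 ∣ n) → Omega n (all-once n)
  all-once∈Ω n 0<n 2∤n = (subst (0 <_) (sym (len-all-once n)) 0<n , all-once-zero-sum n 2∤n) , len-all-once n

  module Exchange (n′ : ℕ) (4≤n′ : 4 ≤ n′) where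
    n = suc n′
    open Congruence n

    below : ∀ c → {True (c ≤? 4)} → c < n
    below c {c≤4} = s≤s (≤-trans (toWitness c≤4) 4≤n′)

    distinct : ∀ c d {c≤4 : True (c ≤? 4)} {d≤4 : True (d ≤? 4)} → c ≢ d → ¬ c ≈ d
    distinct c d {c≤4} {d≤4} c≢d c≈d = c≢d (residue-≡ (below c {c≤4}) (below d {d≤4}) c≈d)

    2≉6 : ¬ 2 ≈ 6
    2≉6 2≈6 = distinct 0 4 (λ ()) (+-cancelʳ 2 2≈6)

    difference : ℕ → ℕ → ℕ
    difference x y = y + neg x

    difference-≈ : ∀ {x y c} → x + c ≈ y → difference x y ≈ c
    difference-≈ {x} {y} {c} x+c≈y = begin
      y + neg x          ≈⟨ +-cong (≈-sym x+c≈y) ≈-refl ⟩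
      x + c + neg x      ≡⟨ solve 3 (λ x c m → x :+ c :+ m := c :+ (x :+ m)) refl x c (neg x) ⟩
      c + (x + neg x)    ≈⟨ +-cong ≈-refl (+-neg x) ⟩
      c + 0              ≡⟨ +-identityʳ c ⟩
      c                  ∎
      where open ≈-Reasoning

    element : ℕ → Fin n
    element x = fromℕ< (m%n<n x n)

    element-≈ : ∀ x → toℕ (element x) ≈ x
    element-≈ x = ≈-trans (≡⇒≈ (toℕ-fromℕ< (m%n<n x n))) (%≈ x)

    ExchangePair : Fin n → Fin n → Set
    ExchangePair x y = Σ (Fin n) λ a → Σ (Fin n) λ b →
      a ≢ b × a ≢ x × a ≢ y × toℕ a + toℕ b ≈ toℕ x + toℕ y

    -- a = x + k, b = y - k works unless y - x is k or 2k
    shifted-pair : ∀ x y k → 0 < k → k < n →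
      ¬ difference (toℕ x) (toℕ y) ≈ k → ¬ difference (toℕ x) (toℕ y) ≈ k + k → ExchangePair x y
    shifted-pair x y k 0<k k<n y-x≉k y-x≉2k = a , b , a≢b , a≢x , a≢y , same-sum
      where
      X = toℕ x
      Y = toℕ y
      a = element (X + k)
      b = element (Y + neg k)
      same-sum : toℕ a + toℕ b ≈ X + Y
      same-sum = begin
        toℕ a + toℕ b              ≈⟨ +-cong (element-≈ (X + k)) (element-≈ (Y + neg k)) ⟩
        X + k + (Y + neg k)        ≡⟨ solve 4 (λ x k y m → x :+ k :+ (y :+ m) := x :+ y :+ (k :+ m)) refl X k Y (neg k) ⟩
        X + Y + (k + neg k)        ≈⟨ +-cong (≈-refl {X + Y}) (+-neg k) ⟩
        X + Y + 0                  ≡⟨ +-identityʳ _ ⟩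
        X + Y                      ∎
        where open ≈-Reasoning
      a≢x : a ≢ x
      a≢x a≡x = <⇒≢ 0<k (sym (residue-≡ k<n (s≤s z≤n) (+-cancelʳ X k+X≈X)))
        where
        k+X≈X : k + X ≈ 0 + X
        k+X≈X = ≈-trans (≡⇒≈ (+-comm k X)) (≈-trans (≈-sym (element-≈ (X + k))) (≡⇒≈ (cong toℕ a≡x)))
      a≢y : a ≢ y
      a≢y a≡y = y-x≉k (difference-≈ {X} {Y} {k} (≈-trans (≈-sym (element-≈ (X + k))) (≡⇒≈ (cong toℕ a≡y))))
      a≢b : a ≢ b
      a≢b a≡b = y-x≉2k (difference-≈ {X} {Y} {k + k} (begin
        X + (k + k)           ≡⟨ +-assoc X k k ⟨
        X + k + k             ≈⟨ +-cong (≈-trans (≈-sym (element-≈ (X + k))) (≈-trans (≡⇒≈ (cong toℕ a≡b)) (element-≈ (Y + neg k)))) (≈-refl {k}) ⟩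
        Y + neg k + k         ≡⟨ solve 3 (λ y m k → y :+ m :+ k := y :+ (k :+ m)) refl Y (neg k) k ⟩
        Y + (k + neg k)       ≈⟨ +-cong (≈-refl {Y}) (+-neg k) ⟩
        Y + 0                 ≡⟨ +-identityʳ Y ⟩
        Y                     ∎))
        where open ≈-Reasoning

    -- one of k = 1, 2, 3 always works
    exchange-pair : ∀ x y → ExchangePair x y
    exchange-pair x y with difference (toℕ x) (toℕ y) ≈? 1 | difference (toℕ x) (toℕ y) ≈? 2
    ... | yes d≈1 | _ = shifted-pair x y 2 z<s (below 2)
      (λ d≈2 → distinct 1 2 (λ ()) (≈-trans (≈-sym d≈1) d≈2))
      (λ d≈4 → distinct 1 4 (λ ()) (≈-trans (≈-sym d≈1) d≈4))
    ... | no _ | yes d≈2 = shifted-pair x y 3 z<s (below 3)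
      (λ d≈3 → distinct 2 3 (λ ()) (≈-trans (≈-sym d≈2) d≈3))
      (λ d≈6 → 2≉6 (≈-trans (≈-sym d≈2) d≈6))
    ... | no d≉1 | no d≉2 = shifted-pair x y 1 z<s (below 1) d≉1 d≉2

    GoodPick : Seq n → Set
    GoodPick S = Σ (ZeroSumPick toℕ n (expand S)) λ (ys , _) → count ys ≢ all-once n

    good⇒Ω₁ : ∀ S → GoodPick S → HasSubIn (Ω₁ n) S
    good⇒Ω₁ S ((ys , zs , ys++zs↭ , |ys| , n∣) , ≢once) = count ys , count-⊑ ys zs S ys++zs↭ , count-∈Ω ys |ys| n∣ , ≢once

    exchange : ∀ S ys zs → ys ++ zs ↭ expand S → length ys ≡ n → n ∣ weight toℕ ys →
      count ys ≡ all-once n → 2 ≤ length zs → GoodPick S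
    exchange S ys (_ ∷ []) _ _ _ _ (s≤s ())
    exchange S ys (x ∷ y ∷ zs) ys++xyzs↭ |ys| n∣ ys-once _ with exchange-pair x y
    ... | a , b , a≢b , a≢x , a≢y , a+b≈x+y with remove-two ys a≢b ys-once
    ... | ys₂ , ys↭abys₂ , a-gone =
      (x ∷ y ∷ ys₂ , a ∷ b ∷ zs , perm , trans (↭-length (↭-sym ys↭abys₂)) |ys| , ≈0⇒∣ zero-sum) , a-missing
      where
      perm : x ∷ y ∷ ys₂ ++ a ∷ b ∷ zs ↭ expand S
      perm = begin
        x ∷ y ∷ ys₂ ++ a ∷ b ∷ zs    ↭⟨ prep x (prep y (shifts ys₂ (a ∷ b ∷ []))) ⟩
        x ∷ y ∷ a ∷ b ∷ ys₂ ++ zs    ↭⟨ shifts (x ∷ y ∷ []) (a ∷ b ∷ []) ⟩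
        a ∷ b ∷ x ∷ y ∷ ys₂ ++ zs    ↭⟨ prep a (prep b (shifts (x ∷ y ∷ []) ys₂)) ⟩
        a ∷ b ∷ ys₂ ++ x ∷ y ∷ zs    ↭⟨ ++⁺ʳ (x ∷ y ∷ zs) ys↭abys₂ ⟨
        ys ++ x ∷ y ∷ zs             ↭⟨ ys++xyzs↭ ⟩
        expand S                     ∎
        where open PermutationReasoning
      w₂ = weight toℕ ys₂
      zero-sum : weight toℕ (x ∷ y ∷ ys₂) ≈ 0
      zero-sum = begin
        toℕ x + (toℕ y + w₂)     ≡⟨ +-assoc (toℕ x) (toℕ y) w₂ ⟨
        toℕ x + toℕ y + w₂       ≈⟨ +-cong (≈-sym a+b≈x+y) (≈-refl {w₂}) ⟩
        toℕ a + toℕ b + w₂       ≡⟨ +-assoc (toℕ a) (toℕ b) w₂ ⟩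
        weight toℕ (a ∷ b ∷ ys₂) ≡⟨ sum-↭ (↭-map⁺ toℕ ys↭abys₂) ⟨
        weight toℕ ys            ≈⟨ ∣⇒≈0 n∣ ⟩
        0                        ∎
        where open ≈-Reasoning
      a-missing : count (x ∷ y ∷ ys₂) ≢ all-once n
      a-missing x∷y∷ys₂-once = 0≢1 (begin
        0                        ≡⟨ a-gone ⟨
        occ ys₂ a                ≡⟨ occ-there ys₂ (≢-sym a≢y) ⟨
        occ (y ∷ ys₂) a          ≡⟨ occ-there (y ∷ ys₂) (≢-sym a≢x) ⟨
        occ (x ∷ y ∷ ys₂) a      ≡⟨ cong (λ v → lookup v a) x∷y∷ys₂-once ⟩
        lookup (all-once n) a    ≡⟨ lookup-replicate a 1 ⟩
        1                        ∎)
        where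
        open ≡-Reasoning
        0≢1 : 0 ≢ 1
        0≢1 ()

    -- the pick from EGZ is good, or leaves at least two terms to exchange
    improve : ∀ S → n + n′ ≤ len S → ZeroSumPick toℕ n (expand S) → GoodPick S
    improve S long pick@(ys , zs , ys++zs↭ , |ys| , n∣) with ≡-dec _≟_ (count ys) (all-once n)
    ... | no ≢once = pick , ≢once
    ... | yes ys-once = exchange S ys zs ys++zs↭ |ys| n∣ ys-once (≤-trans (≤-trans (s≤s (s≤s z≤n)) 4≤n′) n′≤|zs|)
      where
      n′≤|zs| : n′ ≤ length zs
      n′≤|zs| = +-cancelˡ-≤ n n′ (length zs) (subst (n + n′ ≤_) (begin
        len S                   ≡⟨ length-expand S ⟨
        length (expand S)       ≡⟨ ↭-length ys++zs↭ ⟨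
        length (ys ++ zs)       ≡⟨ length-++ ys ⟩
        length ys + length zs   ≡⟨ cong (_+ length zs) |ys| ⟩
        n + length zs           ∎) long)
        where open ≡-Reasoning

    Ω₁-forces : Forces (Ω₁ n) (2 * n ∸ 1)
    Ω₁-forces S long = good⇒Ω₁ S (improve S long′ (egz n toℕ (expand S) (subst (n + n′ ≤_) (sym (length-expand S)) long′)))
      where
      long′ : n + n′ ≤ len S
      long′ = subst (_≤ len S) (solve 1 (λ m → m :+ (con 1 :+ (m :+ con 0)) := con 1 :+ m :+ m) refl n′) long

  -- 0^{n-1} 1^{n-1} has length 2n - 2, while an n-term subsequence of it has
  -- between 1 and n - 1 ones, so its sum is not divisible by n: d_Ω(C_n) ≥ 2n - 1
  -- for every Ω ⊆ Omega n
  no-zero-sum-below : ∀ m (Ω : Pred (Seq (2 + m)) 0ℓ) → Ω ⊆ Omega (2 + m) →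
    ∀ t → t < 2 * (2 + m) ∸ 1 → ¬ Forces Ω t
  no-zero-sum-below m Ω Ω⊆Omega t t<2n-1 forces with forces S₀ t≤|S₀|
    where
    S₀ : Seq (2 + m)
    S₀ = suc m ∷ suc m ∷ empty m
    t≤|S₀| : t ≤ len S₀
    t≤|S₀| = ≤-trans (s≤s⁻¹ t<2n-1) (≤-reflexive (trans
      (solve 1 (λ m → m :+ (con 2 :+ (m :+ con 0)) := con 1 :+ m :+ (con 1 :+ m :+ con 0)) refl m)
      (cong (λ l → suc m + (suc m + l)) (sym (len-empty m)))))
  ... | c₀ ∷ c₁ ∷ R , c₀≤ ∷ c₁≤ ∷ R⊑ , ω with below-empty R R⊑ | Ω⊆Omega ω
    where
    below-empty : ∀ {k} (v : Seq k) → v ⊑ empty k → v ≡ empty k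
    below-empty [] [] = refl
    below-empty (.0 ∷ v) (z≤n ∷ v⊑) = cong (0 ∷_) (below-empty v v⊑)
  ... | refl | (_ , n∣σ) , |T| = ones-not-divisible c₁ c₁≤ c₀+c₁≡n (subst (2 + m ∣_) σ≡c₁ n∣σ)
    where
    c₀+c₁≡n : c₀ + c₁ ≡ 2 + m
    c₀+c₁≡n = trans (cong (c₀ +_) (sym (trans (cong (c₁ +_) (len-empty m)) (+-identityʳ c₁)))) |T|
    σ≡c₁ : σ (c₀ ∷ c₁ ∷ empty m) ≡ c₁
    σ≡c₁ = trans (σ≡σ-from (c₀ ∷ c₁ ∷ empty m))
      (trans (cong (λ s → c₁ + 0 + s) (σ-from-empty m 2)) (trans (+-identityʳ _) (+-identityʳ c₁)))
    ones-not-divisible : ∀ c → c ≤ suc m → c₀ + c ≡ 2 + m → ¬ (2 + m ∣ c)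
    ones-not-divisible zero _ c₀+0≡n _ = <⇒≱ (s≤s c₀≤) (≤-reflexive (trans (sym c₀+0≡n) (+-identityʳ c₀)))
    ones-not-divisible (suc c) c≤ _ n∣c = <⇒≱ (s≤s c≤) (∣⇒≤ n∣c)

open ExceptionalSequence using (Ω₁; all-once; all-once∈Ω; module Exchange; no-zero-sum-below)

proposition4p3 : (n : ℕ) → 5 ≤ n → ¬ (2 ∣ n) →
    Σ (Pred (Seq n) 0ℓ) (λ Ω₁ →
    (Ω₁ ⊆ Omega n)
    × Σ (Seq n) (λ T → Omega n T × ¬ Ω₁ T)
    × DEq Ω₁ (2 * n ∸ 1))
proposition4p3 n@(suc n′@(suc m)) (s≤s 4≤n′) 2∤n =
  Ω₁ n , proj₁ ,
  (all-once n , all-once∈Ω n z<s 2∤n , λ (_ , ≢once) → ≢once refl) ,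
  Exchange.Ω₁-forces n′ 4≤n′ ,
  no-zero-sum-below m (Ω₁ n) proj₁
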